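{- If a graph $G$ has property $\mathcal{M}$ and has diameter at most $2$, then $\mathrm{rc}(G)\le 2$.
   Context: In a graph with an edge $2$-colouring, a rainbow path of length $2$ is a path of two edges having different colours. A pair of non-adjacent vertices is dangerous if it is joined by at most $66$ rainbow paths of length $2$; it is sparsely connected if it is joined by at most $66$ paths of length $2$ (rainbow or not). A graph has property $\mathcal{M}$ if it has a spanning subgraph $H$ and an edge $2$-colouring of $H$ such that, with dangerous and sparsely connected pairs taken in $H$ with this colouring: (i) every vertex is in at most $3$ dangerous pairs; (ii) every vertex is joined by edges (of $H$) to both vertices of at most $15$ dangerous pairs; (iii) every vertex is in at most one sparsely connected pair. The rainbow connection number $\mathrm{rc}(G)$ is the minimum number of colours in an edge colouring of $G$ in which every pair of vertices is joined by a path whose edges have distinct colours. -}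

module Defs where

open import Data.Nat using (ℕ; zero; suc; _+_; _≤_; _≤ᵇ_; _<ᵇ_)
open import Data.Bool using (Bool; true; false; if_then_else_; _∧_; not; _xor_)
open import Data.Fin using (Fin; toℕ; _≟_)
import Data.Fin as F
open import Data.List using (List; []; _∷_)
open import Data.List.Relation.Unary.Unique.Propositional using (Unique)
open import Data.Product using (Σ; _×_; ∃; ∃-syntax)
open import Data.Sum using (_⊎_)
open import Relation.Binary.PropositionalEquality using (_≡_; _≢_)
open import Relation.Nullary.Decidable using (⌊_⌋)

record Graph (n : ℕ) : Set where
  field
    adj    : Fin n → Fin n → Bool
    sym    : ∀ u v → adj u v ≡ adj v u
    irrefl : ∀ u → adj u u ≡ false
open Graph public

SpanningSubgraph : ∀ {n} → Graph n → Graph n → Set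
SpanningSubgraph {n} H G = ∀ (u v : Fin n) → adj H u v ≡ true → adj G u v ≡ true

-- An edge colouring of G with k colours: a symmetric function on pairs
-- (only values on edges matter).
record EdgeColouring {n} (G : Graph n) (k : ℕ) : Set where
  field
    col    : Fin n → Fin n → Fin k
    colSym : ∀ u v → col u v ≡ col v u
open EdgeColouring public

count : ∀ {n} → (Fin n → Bool) → ℕ
count {zero}  f = 0
count {suc n} f = (if f F.zero then 1 else 0) + count (λ i → f (F.suc i))

-- Number of unordered pairs {u,v} (u ≠ v) satisfying a (symmetric) predicate,
-- counted as ordered pairs with toℕ u < toℕ v.
countPairs : ∀ {n} → (Fin n → Fin n → Bool) → ℕ
countPairs {zero}  f = 0
countPairs {suc n} f =
  count (λ v → (toℕ (F.zero {n}) <ᵇ toℕ v) ∧ f F.zero v)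
  + countPairs (λ u v → f (F.suc u) (F.suc v))

module _ {n : ℕ} (H : Graph n) (c : EdgeColouring H 2) where

  paths2 : Fin n → Fin n → ℕ
  paths2 u v = count (λ w → adj H u w ∧ adj H w v)

  rainbow2 : Fin n → Fin n → ℕ
  rainbow2 u v = count (λ w → adj H u w ∧ adj H w v
                              ∧ not ⌊ col c u w ≟ col c w v ⌋)

  dangerous : Fin n → Fin n → Bool
  dangerous u v = not ⌊ u ≟ v ⌋ ∧ not (adj H u v) ∧ (rainbow2 u v ≤ᵇ 66)

  sparselyConnected : Fin n → Fin n → Bool
  sparselyConnected u v = not ⌊ u ≟ v ⌋ ∧ not (adj H u v) ∧ (paths2 u v ≤ᵇ 66)

  ConditionsM : Set
  ConditionsM =
    (∀ x → count (dangerous x) ≤ 3)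
    × (∀ x → countPairs (λ u v → dangerous u v ∧ adj H x u ∧ adj H x v) ≤ 15)
    × (∀ x → count (sparselyConnected x) ≤ 1)

PropertyM : ∀ {n} → Graph n → Set
PropertyM {n} G =
  Σ (Graph n) λ H → SpanningSubgraph H G × Σ (EdgeColouring H 2) λ c → ConditionsM H c

DiameterAtMost2 : ∀ {n} → Graph n → Set
DiameterAtMost2 {n} G = ∀ (u v : Fin n) → u ≢ v →
  adj G u v ≡ true ⊎ ∃[ w ] (adj G u w ≡ true × adj G w v ≡ true)

data ColPath {n k} (G : Graph n) (c : EdgeColouring G k)
     : Fin n → Fin n → List (Fin n) → List (Fin k) → Set where
  here : ∀ u → ColPath G c u u (u ∷ []) []
  step : ∀ {u w v vs cs} → adj G u w ≡ true → ColPath G c w v vs cs →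
         ColPath G c u v (u ∷ vs) (col c u w ∷ cs)

RainbowPath : ∀ {n k} (G : Graph n) → EdgeColouring G k → Fin n → Fin n → Set
RainbowPath {n} {k} G c u v =
  Σ (List (Fin n)) λ vs → Σ (List (Fin k)) λ cs →
    ColPath G c u v vs cs × Unique vs × Unique cs

RainbowConnected : ∀ {n k} (G : Graph n) → EdgeColouring G k → Set
RainbowConnected G c = ∀ u v → RainbowPath G c u v

RcAtMost : ∀ {n} → Graph n → ℕ → Set
RcAtMost G k = Σ (EdgeColouring G k) λ c → RainbowConnected G c

module Submission where

-- Let H ⊆ G and the 2-colouring c of H witness property M.  Two distinct
-- vertices that are adjacent in G are joined by an edge, and a non-adjacent
-- pair needs a rainbow path u–w–v.  A non-adjacent pair that is not dangerous
-- has at least 67 rainbow paths in (H, c); call the dangerous non-adjacent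
-- pairs bad.  Starting from c we repair the bad pairs one at a time: choose a
-- middle w whose legs u–w, w–v are not both frozen, recolour an unfrozen leg
-- if the legs agree, and freeze both legs.  Sparse pairs are repaired first
-- (any common G-neighbour is a valid middle, by condition (iii)), then the
-- others through common H-neighbours (at most 66 of the ≥ 67 are blocked, by
-- conditions (i)–(iii)).  An invariant records why each edge is frozen and
-- why each H-edge was recoloured; it bounds the recoloured H-edges at every
-- vertex by 33, so every non-bad pair keeps one of its 67 rainbow paths.

open import Defs hiding (sym; step; here)
open import Data.Nat using (ℕ; zero; suc; _+_; _≤_; _≤ᵇ_; _≤?_; z≤n; s≤s)
open import Data.Nat.Properties
  using (≤-refl; ≤-trans; ≤-reflexive; ≤-antisym; <-irrefl; m≤n+m; +-mono-≤; +-monoˡ-≤; +-monoʳ-≤;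
         +-comm; +-assoc; +-identityʳ; +-commutativeSemigroup; ≤⇒≤ᵇ; ≰⇒>; module ≤-Reasoning)
open import Algebra.Properties.CommutativeSemigroup +-commutativeSemigroup using (interchange)
open import Data.Bool using (Bool; true; false; if_then_else_; _∧_; _∨_; not; T)
open import Data.Bool.Properties using (∧-comm; ∨-comm)
import Data.Bool as Bool
open import Data.Fin using (Fin; _≟_)
import Data.Fin as F
open import Data.Fin.Properties using (suc-injective; any?)
open import Data.Product using (_×_; _,_; ∃; proj₁; proj₂)
open import Data.Empty using (⊥; ⊥-elim)
open import Data.Sum using (_⊎_; inj₁; inj₂)
open import Data.List using (List; []; _∷_; foldl; allFin; cartesianProduct)
open import Data.List.Relation.Unary.Any using (here; there)
open import Data.List.Relation.Unary.All using ([]; _∷_)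
open import Data.List.Relation.Unary.AllPairs using ([]; _∷_)
open import Data.List.Membership.Propositional using (_∈_)
open import Data.List.Membership.Propositional.Properties using (∈-allFin; ∈-cartesianProduct⁺)
open import Relation.Binary.PropositionalEquality
open import Relation.Nullary using (¬_; Dec; yes; no; contradiction)
open import Relation.Nullary.Decidable using (⌊_⌋)

∧-left : ∀ {a b} → a ∧ b ≡ true → a ≡ true
∧-left {true} _ = refl

∧-right : ∀ {a b} → a ∧ b ≡ true → b ≡ true
∧-right {true} ab = ab

∧-intro : ∀ {a b} → a ≡ true → b ≡ true → a ∧ b ≡ true
∧-intro refl refl = refl

∨-elim : ∀ {a b} → a ∨ b ≡ true → a ≡ true ⊎ b ≡ true
∨-elim {true}  _  = inj₁ refl
∨-elim {false} ab = inj₂ ab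

∨-introˡ : ∀ {a b} → a ≡ true → a ∨ b ≡ true
∨-introˡ refl = refl

∨-introʳ : ∀ {a b} → b ≡ true → a ∨ b ≡ true
∨-introʳ {true}  _ = refl
∨-introʳ {false} b = b

not-true : ∀ {a} → not a ≡ true → a ≡ false
not-true {false} _ = refl

not-false : ∀ {a} → a ≡ false → not a ≡ true
not-false refl = refl

true≢false : ∀ {a} → a ≡ true → a ≡ false → ⊥
true≢false refl ()

neither : ∀ {a b} → a ∨ b ≡ false → a ≡ false × b ≡ false
neither {false} {false} _ = refl , refl

not-both : ∀ {a b} → (a ≡ true → b ≡ true → ⊥) → a ∧ b ≡ false
not-both {false} _ = refl
not-both {true} {false} _ = refl
not-both {true} {true} ¬ab = ⊥-elim (¬ab refl refl)

true-or-false : ∀ b → b ≡ true ⊎ b ≡ false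
true-or-false true  = inj₁ refl
true-or-false false = inj₂ refl

∧-swap : ∀ a b c → a ∧ (b ∧ c) ≡ b ∧ (a ∧ c)
∧-swap true  b     c = refl
∧-swap false true  c = refl
∧-swap false false c = refl

_==_ : ∀ {n} → Fin n → Fin n → Bool
x == y = ⌊ x ≟ y ⌋

==-refl : ∀ {n} (x : Fin n) → (x == x) ≡ true
==-refl x with x ≟ x
... | yes _   = refl
... | no  x≢x = contradiction refl x≢x

==-false : ∀ {n} {x y : Fin n} → x ≢ y → (x == y) ≡ false
==-false {x = x} {y} x≢y with x ≟ y
... | yes x≡y = contradiction x≡y x≢y
... | no  _   = refl

==-false⇒≢ : ∀ {n} {x y : Fin n} → (x == y) ≡ false → x ≢ y
==-false⇒≢ {x = x} ne refl = true≢false (==-refl x) ne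

==-sound : ∀ {n} {x y : Fin n} → (x == y) ≡ true → x ≡ y
==-sound {x = x} {y} eq with x ≟ y
... | yes x≡y = x≡y

==-sym : ∀ {n} (x y : Fin n) → (x == y) ≡ (y == x)
==-sym x y with x ≟ y | y ≟ x
... | yes _   | yes _   = refl
... | no  _   | no  _   = refl
... | yes x≡y | no  y≢x = contradiction (sym x≡y) y≢x
... | no  x≢y | yes y≡x = contradiction (sym y≡x) x≢y

ind : Bool → ℕ
ind b = if b then 1 else 0

count-ext : ∀ {n} {f g : Fin n → Bool} → (∀ i → f i ≡ g i) → count f ≡ count g
count-ext {zero}  f≗g = refl
count-ext {suc n} f≗g = cong₂ _+_ (cong ind (f≗g F.zero)) (count-ext (λ i → f≗g (F.suc i)))

count-mono : ∀ {n} {f g : Fin n → Bool} → (∀ i → f i ≡ true → g i ≡ true) → count f ≤ count g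
count-mono {zero}  f⊆g = z≤n
count-mono {suc n} f⊆g = +-mono-≤ (ind-mono (f⊆g F.zero)) (count-mono (λ i → f⊆g (F.suc i)))
  where
    ind-mono : ∀ {a b} → (a ≡ true → b ≡ true) → ind a ≤ ind b
    ind-mono {false} _  = z≤n
    ind-mono {true}  a⇒b rewrite a⇒b refl = ≤-refl

count-∨ : ∀ {n} (f g : Fin n → Bool) → count (λ i → f i ∨ g i) ≤ count f + count g
count-∨ {zero}  f g = z≤n
count-∨ {suc n} f g = begin
    ind (f F.zero ∨ g F.zero) + count (λ i → f (F.suc i) ∨ g (F.suc i))
  ≤⟨ +-mono-≤ (ind-∨ (f F.zero) (g F.zero)) (count-∨ (λ i → f (F.suc i)) (λ i → g (F.suc i))) ⟩
    (ind (f F.zero) + ind (g F.zero)) + (count (λ i → f (F.suc i)) + count (λ i → g (F.suc i)))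
  ≡⟨ interchange (ind (f F.zero)) _ _ _ ⟩
    count f + count g
  ∎
  where
    open ≤-Reasoning
    ind-∨ : ∀ a b → ind (a ∨ b) ≤ ind a + ind b
    ind-∨ false b = ≤-refl
    ind-∨ true  b = s≤s z≤n

count-split : ∀ {n} (f g : Fin n → Bool) →
  count f ≡ count (λ i → f i ∧ g i) + count (λ i → f i ∧ not (g i))
count-split {zero}  f g = refl
count-split {suc n} f g = begin
    ind (f F.zero) + count (λ i → f (F.suc i))
  ≡⟨ cong₂ _+_ (ind-split (f F.zero) (g F.zero)) (count-split (λ i → f (F.suc i)) (λ i → g (F.suc i))) ⟩
    (ind (f F.zero ∧ g F.zero) + ind (f F.zero ∧ not (g F.zero)))
      + (count (λ i → f (F.suc i) ∧ g (F.suc i)) + count (λ i → f (F.suc i) ∧ not (g (F.suc i))))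
  ≡⟨ interchange (ind (f F.zero ∧ g F.zero)) _ _ _ ⟩
    count (λ i → f i ∧ g i) + count (λ i → f i ∧ not (g i))
  ∎
  where
    open ≡-Reasoning
    ind-split : ∀ a b → ind a ≡ ind (a ∧ b) + ind (a ∧ not b)
    ind-split false b     = refl
    ind-split true  false = refl
    ind-split true  true  = refl

count-pos : ∀ {n} (f : Fin n → Bool) {i} → f i ≡ true → 1 ≤ count f
count-pos f {F.zero}  fi rewrite fi = s≤s z≤n
count-pos f {F.suc i} fi = ≤-trans (count-pos (λ j → f (F.suc j)) fi) (m≤n+m _ _)

count-witness : ∀ {n} (f : Fin n → Bool) → 1 ≤ count f → ∃ λ i → f i ≡ true
count-witness {suc n} f pos with f F.zero in f0
... | true  = F.zero , f0
... | false = let (i , fi) = count-witness (λ j → f (F.suc j)) pos in F.suc i , fi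

count-none : ∀ {n} (f : Fin n → Bool) → (∀ i → f i ≡ false) → count f ≡ 0
count-none {zero}  f none = refl
count-none {suc n} f none rewrite none F.zero = count-none (λ j → f (F.suc j)) (λ j → none (F.suc j))

atMostOne⇒count≤1 : ∀ {n} (f : Fin n → Bool) →
  (∀ i j → f i ≡ true → f j ≡ true → i ≡ j) → count f ≤ 1
atMostOne⇒count≤1 {zero}  f uniq = z≤n
atMostOne⇒count≤1 {suc n} f uniq with f F.zero in f0
... | true  = ≤-reflexive (cong suc (count-none _ rest-false))
  where
    rest-false : ∀ j → f (F.suc j) ≡ false
    rest-false j with f (F.suc j) in fj
    ... | false = refl
    ... | true  with () ← uniq F.zero (F.suc j) f0 fj
... | false = atMostOne⇒count≤1 (λ j → f (F.suc j))
                (λ i j fi fj → suc-injective (uniq (F.suc i) (F.suc j) fi fj))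

count≤1⇒atMostOne : ∀ {n} (f : Fin n → Bool) → count f ≤ 1 →
  ∀ {i j} → f i ≡ true → f j ≡ true → i ≡ j
count≤1⇒atMostOne f c≤1 {F.zero}  {F.zero}  fi fj = refl
count≤1⇒atMostOne f c≤1 {F.zero}  {F.suc j} fi fj rewrite fi
  with s≤s () ← ≤-trans (s≤s (count-pos (λ k → f (F.suc k)) fj)) c≤1
count≤1⇒atMostOne f c≤1 {F.suc i} {F.zero}  fi fj rewrite fj
  with s≤s () ← ≤-trans (s≤s (count-pos (λ k → f (F.suc k)) fi)) c≤1
count≤1⇒atMostOne f c≤1 {F.suc i} {F.suc j} fi fj =
  cong F.suc (count≤1⇒atMostOne (λ k → f (F.suc k)) (≤-trans (m≤n+m _ _) c≤1) fi fj)

escape : ∀ {n} (f g : Fin n → Bool) k → suc k ≤ count f →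
  count (λ i → f i ∧ g i) ≤ k → ∃ λ i → f i ∧ not (g i) ≡ true
escape f g k many few = count-witness _ (positive (subst (suc k ≤_) (count-split f g) many) few)
  where
    positive : ∀ {a b} → suc k ≤ a + b → a ≤ k → 1 ≤ b
    positive {a} {zero}  k<a a≤k rewrite +-identityʳ a = ⊥-elim (<-irrefl refl (≤-trans k<a a≤k))
    positive {a} {suc b} _ _ = s≤s z≤n

anyF : ∀ {n} → (Fin n → Bool) → Bool
anyF {zero}  p = false
anyF {suc n} p = p F.zero ∨ anyF (λ i → p (F.suc i))

anyF-intro : ∀ {n} (p : Fin n → Bool) {i} → p i ≡ true → anyF p ≡ true
anyF-intro p {F.zero}  pi rewrite pi = refl
anyF-intro p {F.suc i} pi with p F.zero
... | true  = refl
... | false = anyF-intro (λ j → p (F.suc j)) pi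

anyF-elim : ∀ {n} (p : Fin n → Bool) → anyF p ≡ true → ∃ λ i → p i ≡ true
anyF-elim {suc n} p any with p F.zero in p0
... | true  = F.zero , p0
... | false = let (i , pi) = anyF-elim (λ j → p (F.suc j)) any in F.suc i , pi

exceeds : ∀ {a b} k m → a ≡ true → b ≡ true → a ∧ b ∧ (k ≤ᵇ m) ≡ false → suc m ≤ k
exceeds k m refl refl above with k ≤? m
... | yes k≤m = contradiction (≤⇒≤ᵇ k≤m) (subst T above)
... | no  k≰m = ≰⇒> k≰m

count-single : ∀ {n} (x : Fin n) → count (x ==_) ≡ 1
count-single x = ≤-antisym
  (atMostOne⇒count≤1 (x ==_) (λ i j xi xj → trans (sym (==-sound xi)) (==-sound xj)))
  (count-pos (x ==_) (==-refl x))

count-image : ∀ {m n} (B : Fin m → Bool) (g : Fin m → Fin n) →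
  count (λ w → anyF (λ q → B q ∧ (g q == w))) ≤ count B
count-image {zero}  {n} B g = ≤-reflexive (count-none {n} _ (λ _ → refl))
count-image {suc m} {n} B g = begin
    count (λ w → (B F.zero ∧ (g F.zero == w)) ∨ anyF (λ q → B (F.suc q) ∧ (g (F.suc q) == w)))
  ≤⟨ count-∨ (λ w → B F.zero ∧ (g F.zero == w)) _ ⟩
    count (λ w → B F.zero ∧ (g F.zero == w)) + count (λ w → anyF (λ q → B (F.suc q) ∧ (g (F.suc q) == w)))
  ≤⟨ +-mono-≤ (≤-reflexive (head (B F.zero))) (count-image (λ q → B (F.suc q)) (λ q → g (F.suc q))) ⟩
    count B
  ∎
  where
    open ≤-Reasoning
    head : ∀ b → count (λ w → b ∧ (g F.zero == w)) ≡ ind b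
    head false = count-none {n} _ (λ _ → refl)
    head true  = count-single (g F.zero)

sumF : ∀ {n} → (Fin n → ℕ) → ℕ
sumF {zero}  g = 0
sumF {suc n} g = g F.zero + sumF (λ i → g (F.suc i))

sumF-+ : ∀ {n} (g h : Fin n → ℕ) → sumF (λ i → g i + h i) ≡ sumF g + sumF h
sumF-+ {zero}  g h = refl
sumF-+ {suc n} g h =
  trans (cong ((g F.zero + h F.zero) +_) (sumF-+ (λ i → g (F.suc i)) (λ i → h (F.suc i))))
        (interchange (g F.zero) (h F.zero) _ _)

sumF-ind : ∀ {n} (f : Fin n → Bool) → sumF (λ i → ind (f i)) ≡ count f
sumF-ind {zero}  f = refl
sumF-ind {suc n} f = cong (ind (f F.zero) +_) (sumF-ind (λ i → f (F.suc i)))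

count≤sumF : ∀ {n} (f : Fin n → Bool) (g : Fin n → ℕ) → (∀ i → ind (f i) ≤ g i) → count f ≤ sumF g
count≤sumF {zero}  f g _  = z≤n
count≤sumF {suc n} f g le =
  +-mono-≤ (le F.zero) (count≤sumF (λ i → f (F.suc i)) (λ i → g (F.suc i)) (λ i → le (F.suc i)))

handshake : ∀ {n} (Q : Fin n → Fin n → Bool) → (∀ x y → Q x y ≡ Q y x) → (∀ x → Q x x ≡ false) →
  sumF (λ w → count (Q w)) ≡ countPairs Q + countPairs Q
handshake {zero}  Q Q-sym Q-irr = refl
handshake {suc n} Q Q-sym Q-irr = begin
    count (Q F.zero) + sumF (λ w → ind (Q (F.suc w) F.zero) + count (λ v → Q (F.suc w) (F.suc v)))
  ≡⟨ cong₂ _+_ (cong (λ b → ind b + A) (Q-irr F.zero)) (sumF-+ (λ w → ind (Q (F.suc w) F.zero)) _) ⟩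
    A + (sumF (λ w → ind (Q (F.suc w) F.zero)) + R)
  ≡⟨ cong (λ a → A + (a + R)) (trans (sumF-ind (λ w → Q (F.suc w) F.zero))
                                      (count-ext (λ w → Q-sym (F.suc w) F.zero))) ⟩
    A + (A + R)
  ≡⟨ cong (λ p → A + (A + p)) (handshake (λ x y → Q (F.suc x) (F.suc y))
                                 (λ x y → Q-sym (F.suc x) (F.suc y)) (λ x → Q-irr (F.suc x))) ⟩
    A + (A + (P + P))
  ≡⟨ cong (A +_) (sym (+-assoc A P P)) ⟩
    A + ((A + P) + P)
  ≡⟨ cong (λ z → A + (z + P)) (+-comm A P) ⟩
    A + ((P + A) + P)
  ≡⟨ cong (A +_) (+-assoc P A P) ⟩
    A + (P + (A + P))
  ≡⟨ sym (+-assoc A P (A + P)) ⟩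
    (A + P) + (A + P)
  ∎
  where
    open ≡-Reasoning
    A = count (λ v → Q F.zero (F.suc v))
    P = countPairs (λ x y → Q (F.suc x) (F.suc y))
    R = sumF (λ w → count (λ v → Q (F.suc w) (F.suc v)))

covered≤2·pairs : ∀ {n} (Q : Fin n → Fin n → Bool) → (∀ x y → Q x y ≡ Q y x) → (∀ x → Q x x ≡ false) →
  count (λ w → anyF (Q w)) ≤ countPairs Q + countPairs Q
covered≤2·pairs Q Q-sym Q-irr = begin
    count (λ w → anyF (Q w))
  ≤⟨ count≤sumF _ (λ w → count (Q w)) (λ w → anyF≤count (Q w)) ⟩
    sumF (λ w → count (Q w))
  ≡⟨ handshake Q Q-sym Q-irr ⟩
    countPairs Q + countPairs Q
  ∎
  where
    open ≤-Reasoning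
    anyF≤count : ∀ {n} (p : Fin n → Bool) → ind (anyF p) ≤ count p
    anyF≤count p with anyF p in any
    ... | false = z≤n
    ... | true  = count-pos p (proj₂ (anyF-elim p any))

module Iteration {S X : Set} (step : S → X → S) where

  run-preserves : (P : S → Set) → (∀ s x → P s → P (step s x)) →
    ∀ xs {s} → P s → P (foldl step s xs)
  run-preserves P keep []       Ps = Ps
  run-preserves P keep (x ∷ xs) Ps = run-preserves P keep xs (keep _ x Ps)

  run-establishes : (P Q : S → Set) → (∀ s x → P s → P (step s x)) →
    (∀ s y → P s → Q s → Q (step s y)) →
    ∀ {x xs s} → x ∈ xs → (∀ s → P s → Q (step s x)) → P s → Q (foldl step s xs)
  run-establishes P Q keepP keepQ {x} {x ∷ xs} (here refl) est Ps =
    proj₂ (run-preserves (λ s → P s × Q s) (λ s y (Ps , Qs) → keepP s y Ps , keepQ s y Ps Qs)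
                         xs (keepP _ x Ps , est _ Ps))
  run-establishes P Q keepP keepQ {x} {y ∷ xs} (there x∈xs) est Ps =
    run-establishes P Q keepP keepQ x∈xs est (keepP _ y Ps)

other : Fin 2 → Fin 2
other F.zero         = F.suc F.zero
other (F.suc F.zero) = F.zero

other-≢ : ∀ a → other a ≢ a
other-≢ F.zero         ()
other-≢ (F.suc F.zero) ()

-- Which leg of a two-edge path u–w–v to recolour when both legs have the same
-- colour, given whether each leg is frozen and whether it is an edge of H:
-- recolour the left leg if the right one is frozen, or if the left one is free
-- and recolouring it does not spend an H-edge where the right leg would not.
chooseLeft : (fixedL fixedR inHL inHR : Bool) → Bool
chooseLeft fl fr hl hr = fr ∨ (not fl ∧ (not hl ∨ hr))

chooseLeft-free : ∀ fl fr hl hr → chooseLeft fl fr hl hr ≡ true → fl ∧ fr ≡ false → fl ≡ false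
chooseLeft-free false fr    hl hr _  _  = refl
chooseLeft-free true  true  hl hr _  ()
chooseLeft-free true  false hl hr () _

chooseRight-free : ∀ fl fr hl hr → chooseLeft fl fr hl hr ≡ false → fr ≡ false
chooseRight-free fl true  hl hr ()
chooseRight-free fl false hl hr _ = refl

chooseLeft-inH : ∀ fl fr hl hr → chooseLeft fl fr hl hr ≡ true → hl ≡ true → hr ≡ false → fr ≡ true
chooseLeft-inH fl    true  hl hr _ _ _ = refl
chooseLeft-inH false false hl hr () refl refl
chooseLeft-inH true  false hl hr () refl refl

chooseRight-inH : ∀ fl fr hl hr → chooseLeft fl fr hl hr ≡ false → hr ≡ true → hl ≡ false → fl ≡ true
chooseRight-inH true  fr    hl hr _  _    _    = refl
chooseRight-inH false true  hl hr () _    _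
chooseRight-inH false false hl hr () refl refl

SameEdge : ∀ {n} → Fin n → Fin n → Fin n → Fin n → Set
SameEdge a b x y = (x ≡ a × y ≡ b) ⊎ (x ≡ b × y ≡ a)

isEdge : ∀ {n} → Fin n → Fin n → Fin n → Fin n → Bool
isEdge a b x y = (x == a ∧ y == b) ∨ (x == b ∧ y == a)

isEdge-sound : ∀ {n} {a b x y : Fin n} → isEdge a b x y ≡ true → SameEdge a b x y
isEdge-sound e with ∨-elim e
... | inj₁ p = inj₁ (==-sound (∧-left p) , ==-sound (∧-right p))
... | inj₂ p = inj₂ (==-sound (∧-left p) , ==-sound (∧-right p))

isEdge-complete : ∀ {n} {a b x y : Fin n} → SameEdge a b x y → isEdge a b x y ≡ true
isEdge-complete {a = a} {b} (inj₁ (refl , refl)) = ∨-introˡ (∧-intro (==-refl a) (==-refl b))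
isEdge-complete {a = a} {b} (inj₂ (refl , refl)) = ∨-introʳ (∧-intro (==-refl b) (==-refl a))

isEdge-here : ∀ {n} (a b : Fin n) → isEdge a b a b ≡ true
isEdge-here a b = isEdge-complete {a = a} {b} (inj₁ (refl , refl))

isEdge-swap : ∀ {n} (a b : Fin n) → isEdge a b b a ≡ true
isEdge-swap a b = isEdge-complete {a = a} {b} (inj₂ (refl , refl))

isEdge-false : ∀ {n} {a b x y : Fin n} → ¬ SameEdge a b x y → isEdge a b x y ≡ false
isEdge-false {a = a} {b} {x} {y} ¬same with isEdge a b x y in e
... | false = refl
... | true  = contradiction (isEdge-sound e) ¬same

isEdge-flip : ∀ {n} (a b x y : Fin n) → isEdge a b x y ≡ isEdge a b y x
isEdge-flip a b x y = trans (cong₂ _∨_ (∧-comm (x == a) (y == b)) (∧-comm (x == b) (y == a)))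
                            (∨-comm (y == b ∧ x == a) (y == a ∧ x == b))

recolour : ∀ {n} → Fin n → Fin n → (Fin n → Fin n → Fin 2) → Fin n → Fin n → Fin 2
recolour a b f x y = if isEdge a b x y then other (f x y) else f x y

recolour-sym : ∀ {n} (a b : Fin n) {f : Fin n → Fin n → Fin 2} → (∀ x y → f x y ≡ f y x) →
  ∀ x y → recolour a b f x y ≡ recolour a b f y x
recolour-sym a b f-sym x y rewrite isEdge-flip a b x y | f-sym x y = refl

recolour-here : ∀ {n} {a b x y : Fin n} (f : Fin n → Fin n → Fin 2) → SameEdge a b x y →
  recolour a b f x y ≡ other (f x y)
recolour-here f same rewrite isEdge-complete same = refl

recolour-away : ∀ {n} {a b x y : Fin n} (f : Fin n → Fin n → Fin 2) → ¬ SameEdge a b x y →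
  recolour a b f x y ≡ f x y
recolour-away f ¬same rewrite isEdge-false ¬same = refl

recolour-cases : ∀ {n} (a b : Fin n) (f : Fin n → Fin n → Fin 2) x y →
  recolour a b f x y ≡ f x y ⊎ SameEdge a b x y
recolour-cases a b f x y with isEdge a b x y in e
... | false = inj₁ refl
... | true  = inj₂ (isEdge-sound e)

module _ {n k : ℕ} {G : Graph n} (κ : EdgeColouring G k) where

  trivialPath : ∀ u → RainbowPath G κ u u
  trivialPath u = u ∷ [] , [] , Defs.here u , [] ∷ [] , []

  edgePath : ∀ {u v} → u ≢ v → adj G u v ≡ true → RainbowPath G κ u v
  edgePath {u} {v} u≢v uv =
    u ∷ v ∷ [] , col κ u v ∷ [] , Defs.step uv (Defs.here v) , (u≢v ∷ []) ∷ [] ∷ [] , [] ∷ []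

  twoEdgePath : ∀ {u w v} → u ≢ v → adj G u w ≡ true → adj G w v ≡ true →
    col κ u w ≢ col κ w v → RainbowPath G κ u v
  twoEdgePath {u} {w} {v} u≢v uw wv distinct =
    u ∷ w ∷ v ∷ [] , col κ u w ∷ col κ w v ∷ [] , Defs.step uw (Defs.step wv (Defs.here v)) ,
    (u≢w ∷ u≢v ∷ []) ∷ (w≢v ∷ []) ∷ [] ∷ [] , (distinct ∷ []) ∷ [] ∷ []
    where
      u≢w : u ≢ w
      u≢w refl = true≢false uw (Graph.irrefl G u)
      w≢v : w ≢ v
      w≢v refl = true≢false wv (Graph.irrefl G w)

module Setting {n : ℕ} (G H : Graph n) (c : EdgeColouring H 2)
               (H⊆G : SpanningSubgraph H G) (M : ConditionsM H c) where

  aG aH : Fin n → Fin n → Bool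
  aG = adj G
  aH = adj H

  c₀ : Fin n → Fin n → Fin 2
  c₀ = col c

  dang sparse : Fin n → Fin n → Bool
  dang   = dangerous H c
  sparse = sparselyConnected H c

  bad : Fin n → Fin n → Bool
  bad u v = dang u v ∧ not (aG u v)

  aG-sym : ∀ x y → aG x y ≡ aG y x
  aG-sym = Graph.sym G

  aH-sym : ∀ x y → aH x y ≡ aH y x
  aH-sym = Graph.sym H

  aG-≢ : ∀ {x y} → aG x y ≡ true → x ≢ y
  aG-≢ {x} e refl = true≢false e (Graph.irrefl G x)

  ¬aG⇒¬aH : ∀ {x y} → aG x y ≡ false → aH x y ≡ false
  ¬aG⇒¬aH {x} {y} ¬e with aH x y in e
  ... | false = refl
  ... | true  = ⊥-elim (true≢false (H⊆G x y e) ¬e)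

  paths2-sym : ∀ u v → paths2 H c u v ≡ paths2 H c v u
  paths2-sym u v = count-ext λ w →
    trans (cong₂ _∧_ (aH-sym u w) (aH-sym w v)) (∧-comm (aH w u) (aH v w))

  rainbow2-sym : ∀ u v → rainbow2 H c u v ≡ rainbow2 H c v u
  rainbow2-sym u v = count-ext λ w → begin
      aH u w ∧ aH w v ∧ not (c₀ u w == c₀ w v)
    ≡⟨ cong₂ (λ a b → aH u w ∧ aH w v ∧ not (a == b)) (colSym c u w) (colSym c w v) ⟩
      aH u w ∧ aH w v ∧ not (c₀ w u == c₀ v w)
    ≡⟨ cong₂ (λ a b → a ∧ b ∧ not (c₀ w u == c₀ v w)) (aH-sym u w) (aH-sym w v) ⟩
      aH w u ∧ aH v w ∧ not (c₀ w u == c₀ v w)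
    ≡⟨ ∧-swap (aH w u) (aH v w) _ ⟩
      aH v w ∧ aH w u ∧ not (c₀ w u == c₀ v w)
    ≡⟨ cong (λ b → aH v w ∧ aH w u ∧ not b) (==-sym (c₀ w u) (c₀ v w)) ⟩
      aH v w ∧ aH w u ∧ not (c₀ v w == c₀ w u)
    ∎
    where open ≡-Reasoning

  dang-sym : ∀ u v → dang u v ≡ dang v u
  dang-sym u v rewrite ==-sym u v | aH-sym u v | rainbow2-sym u v = refl

  sparse-sym : ∀ u v → sparse u v ≡ sparse v u
  sparse-sym u v rewrite ==-sym u v | aH-sym u v | paths2-sym u v = refl

  bad-sym : ∀ u v → bad u v ≡ bad v u
  bad-sym u v rewrite dang-sym u v | aG-sym u v = refl

  dang-≢ : ∀ {u v} → dang u v ≡ true → u ≢ v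
  dang-≢ {u} e refl rewrite ==-refl u = true≢false e refl

  sparse-unique : ∀ x {y y′} → sparse x y ≡ true → sparse x y′ ≡ true → y ≡ y′
  sparse-unique x = count≤1⇒atMostOne (sparse x) (proj₂ (proj₂ M) x)

  bad-bound : ∀ x → count (bad x) ≤ 3
  bad-bound x = ≤-trans (count-mono (λ q b → ∧-left {dang x q} b)) (proj₁ M x)

  dangerNbr : Fin n → Fin n → Bool
  dangerNbr x w = anyF (λ p → dang w p ∧ aH x w ∧ aH x p)

  dangerNbr-bound : ∀ x → count (dangerNbr x) ≤ 30
  dangerNbr-bound x = ≤-trans (covered≤2·pairs Q Q-sym Q-irr)
                              (+-mono-≤ (proj₁ (proj₂ M) x) (proj₁ (proj₂ M) x))
    where
      Q : Fin n → Fin n → Bool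
      Q a b = dang a b ∧ aH x a ∧ aH x b
      Q-sym : ∀ a b → Q a b ≡ Q b a
      Q-sym a b = cong₂ _∧_ (dang-sym a b) (∧-comm (aH x a) (aH x b))
      Q-irr : ∀ a → Q a a ≡ false
      Q-irr a rewrite ==-refl a = refl

  middleOf : (Fin n → Fin n → Fin n) → Fin n → Fin n → Bool
  middleOf m x w = anyF (λ q → bad x q ∧ (m x q == w))

  middleOf-bound : ∀ m x → count (middleOf m x) ≤ 3
  middleOf-bound m x = ≤-trans (count-image (bad x) (m x)) (bad-bound x)

  record State : Set where
    constructor state
    field
      colour : Fin n → Fin n → Fin 2
      fixed  : Fin n → Fin n → Bool
      done   : Fin n → Fin n → Bool
      mid    : Fin n → Fin n → Fin n
  open State

  record RainbowVia (s : State) (x y m : Fin n) : Set where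
    field
      edgeˡ   : aG x m ≡ true
      edgeʳ   : aG m y ≡ true
      fixedˡ  : fixed s x m ≡ true
      fixedʳ  : fixed s m y ≡ true
      rainbow : colour s x m ≢ colour s m y
      inH     : sparse x y ≡ false → aH x m ≡ true × aH m y ≡ true

  data Leg (s : State) (a w : Fin n) : Set where
    endpoint : ∀ {q} → done s a q ≡ true → mid s a q ≡ w → Leg s a w
    middle   : ∀ {p} → done s w p ≡ true → mid s w p ≡ a → Leg s a w

  -- Why an H-edge a–w may have lost its colour from c.  The three cases are
  -- what the final count of recoloured edges at a vertex a relies on.
  data Recoloured (s : State) (a w : Fin n) : Set where
    endpoint : ∀ {q} → done s a q ≡ true → mid s a q ≡ w → Recoloured s a w
    middle   : ∀ {p} → done s w p ≡ true → mid s w p ≡ a → aH a p ≡ true → Recoloured s a w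
    forced   : ∀ {p r} → done s w p ≡ true → sparse w p ≡ true → mid s w p ≡ a → aH a p ≡ false →
               done s a r ≡ true → sparse a r ≡ true → mid s a r ≡ p → Recoloured s a w

  record Invariant (sparsePhase : Bool) (s : State) : Set where
    field
      colour-sym   : ∀ x y → colour s x y ≡ colour s y x
      fixed-sym    : ∀ x y → fixed s x y ≡ fixed s y x
      done-sym     : ∀ x y → done s x y ≡ done s y x
      done⇒bad     : ∀ x y → done s x y ≡ true → bad x y ≡ true
      done⇒rainbow : ∀ x y → done s x y ≡ true → RainbowVia s x y (mid s x y)
      fixed⇒leg    : ∀ a w → fixed s a w ≡ true → Leg s a w
      recoloured   : ∀ a w → aH a w ≡ true → colour s a w ≢ c₀ a w → Recoloured s a w
      only-sparse  : sparsePhase ≡ true → ∀ x y → done s x y ≡ true → sparse x y ≡ true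

  initial : State
  initial = state (λ x y → if aH x y then c₀ x y else F.zero) (λ _ _ → false) (λ _ _ → false) (λ x _ → x)

  initial-invariant : Invariant true initial
  initial-invariant = record
    { colour-sym   = λ x y → cong₂ (λ b k → if b then k else F.zero) (aH-sym x y) (colSym c x y)
    ; fixed-sym    = λ _ _ → refl
    ; done-sym     = λ _ _ → refl
    ; done⇒bad     = λ _ _ ()
    ; done⇒rainbow = λ _ _ ()
    ; fixed⇒leg    = λ _ _ ()
    ; recoloured   = λ a w inH changed → contradiction (on-H inH) changed
    ; only-sparse  = λ _ _ _ ()
    }
    where
      on-H : ∀ {a w} → aH a w ≡ true → (if aH a w then c₀ a w else F.zero) ≡ c₀ a w
      on-H inH rewrite inH = refl

  inPhase : Bool → Fin n → Fin n → Bool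
  inPhase sparsePhase u v = if sparsePhase then sparse u v else not (sparse u v)

  inPhase-cases : ∀ φ u v → inPhase φ u v ≡ true →
    (φ ≡ true × sparse u v ≡ true) ⊎ (φ ≡ false × sparse u v ≡ false)
  inPhase-cases true  _ _ sp  = inj₁ (refl , sp)
  inPhase-cases false _ _ ¬sp = inj₂ (refl , not-true ¬sp)

  eligible : Bool → State → Fin n → Fin n → Bool
  eligible φ s u v = bad u v ∧ not (done s u v) ∧ inPhase φ u v

  candidate : State → Fin n → Fin n → Fin n → Bool
  candidate s u v w = aG u w ∧ aG w v ∧ (sparse u v ∨ (aH u w ∧ aH w v)) ∧ not (fixed s u w ∧ fixed s w v)

  module Repair (s : State) (u v w : Fin n) where
    clash flipLeft : Bool
    clash    = colour s u w == colour s w v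
    flipLeft = chooseLeft (fixed s u w) (fixed s w v) (aH u w) (aH w v)

    recolourLeg : (clash? left? : Bool) → Fin n → Fin n → Fin 2
    recolourLeg false _     = colour s
    recolourLeg true  true  = recolour u w (colour s)
    recolourLeg true  false = recolour w v (colour s)

    newColour : Fin n → Fin n → Fin 2
    newColour = recolourLeg clash flipLeft

    newColour≡ : ∀ {b l} → clash ≡ b → flipLeft ≡ l → ∀ x y → newColour x y ≡ recolourLeg b l x y
    newColour≡ cl fl x y = cong₂ (λ b l → recolourLeg b l x y) cl fl

    after : State
    after = state newColour
                  (λ x y → fixed s x y ∨ isEdge u w x y ∨ isEdge w v x y)
                  (λ x y → done s x y ∨ isEdge u v x y)
                  (λ x y → if isEdge u v x y then w else mid s x y)

    data Change (x y : Fin n) : Set where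
      kept  : newColour x y ≡ colour s x y → Change x y
      left  : clash ≡ true → flipLeft ≡ true  → SameEdge u w x y → Change x y
      right : clash ≡ true → flipLeft ≡ false → SameEdge w v x y → Change x y

    change : ∀ x y → Change x y
    change x y with clash in cl | flipLeft in fl
    ... | false | _ = kept (newColour≡ cl fl x y)
    ... | true  | true  with recolour-cases u w (colour s) x y
    ...   | inj₁ same = kept (trans (newColour≡ cl fl x y) same)
    ...   | inj₂ edge = left cl fl edge
    change x y | true | false with recolour-cases w v (colour s) x y
    ...   | inj₁ same = kept (trans (newColour≡ cl fl x y) same)
    ...   | inj₂ edge = right cl fl edge

  module EligiblePair {φ : Bool} {s : State} (I : Invariant φ s) {u v : Fin n}
                      (elig : eligible φ s u v ≡ true) where
    open Invariant I

    uv-bad : bad u v ≡ true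
    uv-bad = ∧-left elig

    uv-new : done s u v ≡ false
    uv-new = not-true (∧-left (∧-right {bad u v} elig))

    uv-phase : inPhase φ u v ≡ true
    uv-phase = ∧-right (∧-right {bad u v} elig)

    u≢v : u ≢ v
    u≢v = dang-≢ (∧-left uv-bad)

    uv-¬G : aG u v ≡ false
    uv-¬G = not-true (∧-right {dang u v} uv-bad)

    -- In the sparse phase u and v are in no repaired pair: their only
    -- sparse partners are each other.
    u-untouched : φ ≡ true → ∀ {q} → done s u q ≡ true → ⊥
    u-untouched φ≡true {q} d with inPhase-cases φ u v uv-phase
    ... | inj₂ (φ≡false , _) = true≢false φ≡true φ≡false
    ... | inj₁ (_ , sp) = true≢false (subst (λ z → done s u z ≡ true) q≡v d) uv-new
      where
        q≡v : q ≡ v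
        q≡v = sparse-unique u (only-sparse φ≡true u q d) sp

    v-untouched : φ ≡ true → ∀ {p} → done s v p ≡ true → ⊥
    v-untouched φ≡true {p} d with inPhase-cases φ u v uv-phase
    ... | inj₂ (φ≡false , _) = true≢false φ≡true φ≡false
    ... | inj₁ (_ , sp) = true≢false (trans (done-sym u v) (subst (λ z → done s v z ≡ true) p≡u d)) uv-new
      where
        p≡u : p ≡ u
        p≡u = sparse-unique v (only-sparse φ≡true v p d) (trans (sparse-sym v u) sp)

    fresh : ∀ {x y} → done s x y ≡ true → ¬ SameEdge u v x y
    fresh d (inj₁ (refl , refl)) = true≢false d uv-new
    fresh d (inj₂ (refl , refl)) = true≢false (trans (done-sym u v) d) uv-new

  module RepairStep {φ : Bool} {s : State} (I : Invariant φ s) {u v w : Fin n}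
                    (elig : eligible φ s u v ≡ true) (cand : candidate s u v w ≡ true) where
    open Invariant I
    open EligiblePair I {u} {v} elig
    open Repair s u v w

    uw-G : aG u w ≡ true
    uw-G = ∧-left cand

    wv-G : aG w v ≡ true
    wv-G = ∧-left (∧-right {aG u w} cand)

    legs-H : sparse u v ≡ false → aH u w ≡ true × aH w v ≡ true
    legs-H ¬sp with ∨-elim (∧-left (∧-right {aG w v} (∧-right {aG u w} cand)))
    ... | inj₁ sp = ⊥-elim (true≢false sp ¬sp)
    ... | inj₂ hh = ∧-left hh , ∧-right hh

    not-both-fixed : fixed s u w ∧ fixed s w v ≡ false
    not-both-fixed = not-true (∧-right (∧-right {aG w v} (∧-right {aG u w} cand)))

    u≢w : u ≢ w
    u≢w = aG-≢ uw-G

    done-kept : ∀ {x y} → done s x y ≡ true → done after x y ≡ true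
    done-kept = ∨-introˡ

    mid-kept : ∀ {x y} → done s x y ≡ true → mid after x y ≡ mid s x y
    mid-kept d rewrite isEdge-false (fresh d) = refl

    done-uv : done after u v ≡ true
    done-uv = ∨-introʳ {done s u v} (isEdge-here u v)

    done-vu : done after v u ≡ true
    done-vu = ∨-introʳ {done s v u} (isEdge-swap u v)

    mid-uv : mid after u v ≡ w
    mid-uv rewrite isEdge-here u v = refl

    mid-vu : mid after v u ≡ w
    mid-vu rewrite isEdge-swap u v = refl

    leg-kept : ∀ {a b} → Leg s a b → Leg after a b
    leg-kept (endpoint d m) = endpoint (done-kept d) (trans (mid-kept d) m)
    leg-kept (middle d m)   = middle (done-kept d) (trans (mid-kept d) m)

    recoloured-kept : ∀ {a b} → Recoloured s a b → Recoloured after a b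
    recoloured-kept (endpoint d m)     = endpoint (done-kept d) (trans (mid-kept d) m)
    recoloured-kept (middle d m h)     = middle (done-kept d) (trans (mid-kept d) m) h
    recoloured-kept (forced d sp m h d′ sp′ m′) =
      forced (done-kept d) sp (trans (mid-kept d) m) h (done-kept d′) sp′ (trans (mid-kept d′) m′)

    ¬left-at-right : ¬ SameEdge u w w v
    ¬left-at-right (inj₁ (w≡u , _)) = u≢w (sym w≡u)
    ¬left-at-right (inj₂ (_ , v≡u)) = u≢v (sym v≡u)

    ¬right-at-left : ¬ SameEdge w v u w
    ¬right-at-left (inj₁ (u≡w , _)) = u≢w u≡w
    ¬right-at-left (inj₂ (u≡v , _)) = u≢v u≡v

    -- The recoloured leg is never frozen, so frozen edges keep their colour.
    left-unfrozen : flipLeft ≡ true → fixed s u w ≡ false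
    left-unfrozen fl = chooseLeft-free (fixed s u w) (fixed s w v) (aH u w) (aH w v) fl not-both-fixed

    right-unfrozen : flipLeft ≡ false → fixed s w v ≡ false
    right-unfrozen = chooseRight-free (fixed s u w) (fixed s w v) (aH u w) (aH w v)

    colour-frozen : ∀ {x y} → fixed s x y ≡ true → newColour x y ≡ colour s x y
    colour-frozen {x} {y} fx with change x y
    ... | kept eq = eq
    ... | left  _ fl (inj₁ (refl , refl)) = ⊥-elim (true≢false fx (left-unfrozen fl))
    ... | left  _ fl (inj₂ (refl , refl)) = ⊥-elim (true≢false (trans (fixed-sym u w) fx) (left-unfrozen fl))
    ... | right _ fl (inj₁ (refl , refl)) = ⊥-elim (true≢false fx (right-unfrozen fl))
    ... | right _ fl (inj₂ (refl , refl)) = ⊥-elim (true≢false (trans (fixed-sym w v) fx) (right-unfrozen fl))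

    newColour-sym : ∀ x y → newColour x y ≡ newColour y x
    newColour-sym x y with clash | flipLeft
    ... | false | _     = colour-sym x y
    ... | true  | true  = recolour-sym u w colour-sym x y
    ... | true  | false = recolour-sym w v colour-sym x y

    legs-differ : newColour u w ≢ newColour w v
    legs-differ with clash in cl | flipLeft
    ... | false | _ = ==-false⇒≢ cl
    ... | true | true = λ eq → other-≢ (colour s w v) (begin
        other (colour s w v)                   ≡⟨ cong other (sym (==-sound cl)) ⟩
        other (colour s u w)                   ≡⟨ sym (recolour-here (colour s) (inj₁ (refl , refl))) ⟩
        recolour u w (colour s) u w            ≡⟨ eq ⟩
        recolour u w (colour s) w v            ≡⟨ recolour-away (colour s) ¬left-at-right ⟩
        colour s w v                           ∎)
      where open ≡-Reasoning
    ... | true | false = λ eq → other-≢ (colour s u w) (begin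
        other (colour s u w)                   ≡⟨ cong other (==-sound cl) ⟩
        other (colour s w v)                   ≡⟨ sym (recolour-here (colour s) (inj₁ (refl , refl))) ⟩
        recolour w v (colour s) w v            ≡⟨ sym eq ⟩
        recolour w v (colour s) u w            ≡⟨ recolour-away (colour s) ¬right-at-left ⟩
        colour s u w                           ∎)
      where open ≡-Reasoning

    fixed-uw : fixed after u w ≡ true
    fixed-uw = ∨-introʳ {fixed s u w} (∨-introˡ (isEdge-here u w))

    fixed-wv : fixed after w v ≡ true
    fixed-wv = ∨-introʳ {fixed s w v} (∨-introʳ {isEdge u w w v} (isEdge-here w v))

    fixed-kept : ∀ {x y} → fixed s x y ≡ true → fixed after x y ≡ true
    fixed-kept = ∨-introˡ

    fixed-sym′ : ∀ x y → fixed after x y ≡ fixed after y x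
    fixed-sym′ x y rewrite isEdge-flip u w x y | isEdge-flip w v x y | fixed-sym x y = refl

    done-sym′ : ∀ x y → done after x y ≡ done after y x
    done-sym′ x y rewrite isEdge-flip u v x y | done-sym x y = refl

    rainbow-uv : RainbowVia after u v w
    rainbow-uv = record
      { edgeˡ = uw-G ; edgeʳ = wv-G ; fixedˡ = fixed-uw ; fixedʳ = fixed-wv
      ; rainbow = legs-differ ; inH = legs-H }

    rainbow-vu : RainbowVia after v u w
    rainbow-vu = record
      { edgeˡ   = trans (aG-sym v w) wv-G
      ; edgeʳ   = trans (aG-sym w u) uw-G
      ; fixedˡ  = trans (fixed-sym′ v w) fixed-wv
      ; fixedʳ  = trans (fixed-sym′ w u) fixed-uw
      ; rainbow = λ eq → legs-differ (trans (newColour-sym u w) (trans (sym eq) (newColour-sym v w)))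
      ; inH     = λ ¬sp → let (uw , wv) = legs-H (trans (sparse-sym u v) ¬sp)
                          in trans (aH-sym v w) wv , trans (aH-sym w u) uw
      }

    -- Earlier rainbow paths survive, as they only use frozen edges.
    rainbow-kept : ∀ {x y m} → RainbowVia s x y m → RainbowVia after x y m
    rainbow-kept r = record
      { edgeˡ = edgeˡ ; edgeʳ = edgeʳ
      ; fixedˡ = fixed-kept fixedˡ ; fixedʳ = fixed-kept fixedʳ
      ; rainbow = λ eq → rainbow (trans (sym (colour-frozen fixedˡ)) (trans eq (colour-frozen fixedʳ)))
      ; inH = inH }
      where open RainbowVia r

    done-cases : ∀ {x y} → done after x y ≡ true → done s x y ≡ true ⊎ SameEdge u v x y
    done-cases d with ∨-elim d
    ... | inj₁ old = inj₁ old
    ... | inj₂ new = inj₂ (isEdge-sound new)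

    done⇒bad′ : ∀ x y → done after x y ≡ true → bad x y ≡ true
    done⇒bad′ x y d with done-cases d
    ... | inj₁ old = done⇒bad x y old
    ... | inj₂ (inj₁ (refl , refl)) = uv-bad
    ... | inj₂ (inj₂ (refl , refl)) = trans (bad-sym v u) uv-bad

    done⇒rainbow′ : ∀ x y → done after x y ≡ true → RainbowVia after x y (mid after x y)
    done⇒rainbow′ x y d with done-cases d
    ... | inj₁ old = subst (RainbowVia after x y) (sym (mid-kept old)) (rainbow-kept (done⇒rainbow x y old))
    ... | inj₂ (inj₁ (refl , refl)) = subst (RainbowVia after u v) (sym mid-uv) rainbow-uv
    ... | inj₂ (inj₂ (refl , refl)) = subst (RainbowVia after v u) (sym mid-vu) rainbow-vu

    only-sparse′ : φ ≡ true → ∀ x y → done after x y ≡ true → sparse x y ≡ true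
    only-sparse′ φ≡true x y d with done-cases d | inPhase-cases φ u v uv-phase
    ... | inj₁ old | _ = only-sparse φ≡true x y old
    ... | inj₂ _ | inj₂ (φ≡false , _) = ⊥-elim (true≢false φ≡true φ≡false)
    ... | inj₂ (inj₁ (refl , refl)) | inj₁ (_ , sp) = sp
    ... | inj₂ (inj₂ (refl , refl)) | inj₁ (_ , sp) = trans (sparse-sym v u) sp

    fixed⇒leg′ : ∀ a b → fixed after a b ≡ true → Leg after a b
    fixed⇒leg′ a b fx with ∨-elim fx
    ... | inj₁ old = leg-kept (fixed⇒leg a b old)
    ... | inj₂ new with ∨-elim new
    ...   | inj₁ e with isEdge-sound {a = u} {w} {a} {b} e
    ...     | inj₁ (refl , refl) = endpoint done-uv mid-uv
    ...     | inj₂ (refl , refl) = middle done-uv mid-uv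
    fixed⇒leg′ a b fx | inj₂ new | inj₂ e with isEdge-sound {a = w} {v} {a} {b} e
    ...     | inj₁ (refl , refl) = middle done-vu mid-vu
    ...     | inj₂ (refl , refl) = endpoint done-vu mid-vu

    -- A recoloured H-leg seen from the middle w.  If the other leg is not in H,
    -- the pair is sparse and the other leg was frozen by an earlier pair at w.
    left-leg-at-middle : aH u w ≡ true → flipLeft ≡ true → Recoloured after w u
    left-leg-at-middle uw-H fl with true-or-false (aH w v)
    ... | inj₁ wv-H = middle done-uv mid-uv wv-H
    ... | inj₂ wv-¬H with inPhase-cases φ u v uv-phase
    ...   | inj₂ (_ , ¬sp) = ⊥-elim (true≢false (proj₂ (legs-H ¬sp)) wv-¬H)
    ...   | inj₁ (φ≡true , sp)
            with fixed⇒leg w v (chooseLeft-inH (fixed s u w) (fixed s w v) (aH u w) (aH w v) fl uw-H wv-¬H)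
    ...     | endpoint {q} d m = forced done-uv sp mid-uv wv-¬H
                                        (done-kept d) (only-sparse φ≡true w q d) (trans (mid-kept d) m)
    ...     | middle d _ = ⊥-elim (v-untouched φ≡true d)

    right-leg-at-middle : aH w v ≡ true → flipLeft ≡ false → Recoloured after w v
    right-leg-at-middle wv-H fl with true-or-false (aH u w)
    ... | inj₁ uw-H = middle done-vu mid-vu (trans (aH-sym w u) uw-H)
    ... | inj₂ uw-¬H with inPhase-cases φ u v uv-phase
    ...   | inj₂ (_ , ¬sp) = ⊥-elim (true≢false (proj₁ (legs-H ¬sp)) uw-¬H)
    ...   | inj₁ (φ≡true , sp)
            with fixed⇒leg u w (chooseRight-inH (fixed s u w) (fixed s w v) (aH u w) (aH w v) fl wv-H uw-¬H)
    ...     | endpoint d _ = ⊥-elim (u-untouched φ≡true d)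
    ...     | middle {p} d m = forced done-vu (trans (sparse-sym v u) sp) mid-vu (trans (aH-sym w u) uw-¬H)
                                      (done-kept d) (only-sparse φ≡true w p d) (trans (mid-kept d) m)

    recoloured′ : ∀ a b → aH a b ≡ true → newColour a b ≢ c₀ a b → Recoloured after a b
    recoloured′ a b h ne with change a b
    ... | kept eq = recoloured-kept (recoloured a b h (λ e → ne (trans eq e)))
    ... | left  _ fl (inj₁ (refl , refl)) = endpoint done-uv mid-uv
    ... | left  _ fl (inj₂ (refl , refl)) = left-leg-at-middle (trans (aH-sym u w) h) fl
    ... | right _ fl (inj₁ (refl , refl)) = right-leg-at-middle h fl
    ... | right _ fl (inj₂ (refl , refl)) = endpoint done-vu mid-vu

    invariant : Invariant φ after
    invariant = record
      { colour-sym = newColour-sym ; fixed-sym = fixed-sym′ ; done-sym = done-sym′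
      ; done⇒bad = done⇒bad′ ; done⇒rainbow = done⇒rainbow′ ; fixed⇒leg = fixed⇒leg′
      ; recoloured = recoloured′ ; only-sparse = only-sparse′ }

  middle⇒dangerNbr : ∀ {φ s} → Invariant φ s → ∀ {w p} → done s w p ≡ true → sparse w p ≡ false →
    dangerNbr (mid s w p) w ≡ true
  middle⇒dangerNbr {s = s} I {w} {p} d ¬sp =
    anyF-intro (λ p′ → dang w p′ ∧ aH m w ∧ aH m p′) {p}
      (∧-intro (∧-left {dang w p} (Invariant.done⇒bad I w p d)) (∧-intro (trans (aH-sym m w) wm) mp))
    where
      m : Fin n
      m = mid s w p
      open RainbowVia (Invariant.done⇒rainbow I w p d)
      wm : aH w m ≡ true
      wm = proj₁ (inH ¬sp)
      mp : aH m p ≡ true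
      mp = proj₂ (inH ¬sp)

  endpoint⇒middleOf : ∀ {φ s} → Invariant φ s → ∀ {x q w} → done s x q ≡ true → mid s x q ≡ w →
    middleOf (mid s) x w ≡ true
  endpoint⇒middleOf {s = s} I {x} {q} d refl =
    anyF-intro (λ q′ → bad x q′ ∧ (mid s x q′ == mid s x q)) {q}
      (∧-intro (Invariant.done⇒bad I x q d) (==-refl (mid s x q)))

  module Existence (diam : DiameterAtMost2 G) {φ : Bool} {s : State} (I : Invariant φ s)
                   {u v : Fin n} (elig : eligible φ s u v ≡ true) where
    open Invariant I
    open EligiblePair I {u} {v} elig

    -- Were both legs
    -- frozen, w would be the middle of repaired pairs w,p and w,p′ with
    -- middles u and v; both are sparse, so p = p′ and u = v.
    via-common-neighbour : φ ≡ true → sparse u v ≡ true → ∃ λ w → candidate s u v w ≡ true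
    via-common-neighbour φ≡true sp with diam u v u≢v
    ... | inj₁ uv-G = ⊥-elim (true≢false uv-G uv-¬G)
    ... | inj₂ (w , uw-G , wv-G) =
      w , ∧-intro uw-G (∧-intro wv-G (∧-intro (∨-introˡ sp) (not-false (not-both both-frozen))))
      where
        both-frozen : fixed s u w ≡ true → fixed s w v ≡ true → ⊥
        both-frozen fu fv with fixed⇒leg u w fu | fixed⇒leg v w (trans (fixed-sym v w) fv)
        ... | endpoint d _ | _            = u-untouched φ≡true d
        ... | middle _ _   | endpoint d _ = v-untouched φ≡true d
        ... | middle {p} d m | middle {p′} d′ m′ = u≢v (begin
            u           ≡⟨ sym m ⟩
            mid s w p   ≡⟨ cong (mid s w) (sparse-unique w (only-sparse φ≡true w p d) (only-sparse φ≡true w p′ d′)) ⟩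
            mid s w p′  ≡⟨ m′ ⟩
            v           ∎)
          where open ≡-Reasoning

    -- Dense phase: at most 66 common H-neighbours have both legs frozen, since
    -- each of them is a culprit, and there are more than 66 of them.
    culprit : Fin n → Bool
    culprit w = middleOf (mid s) u w ∨ middleOf (mid s) v w ∨ dangerNbr u w ∨ dangerNbr v w

    culprit-bound : count culprit ≤ 66
    culprit-bound = begin
        count culprit
      ≤⟨ count-∨ (middleOf (mid s) u) _ ⟩
        count (middleOf (mid s) u) + count (λ w → middleOf (mid s) v w ∨ dangerNbr u w ∨ dangerNbr v w)
      ≤⟨ +-monoʳ-≤ (count (middleOf (mid s) u)) (count-∨ (middleOf (mid s) v) _) ⟩
        count (middleOf (mid s) u) + (count (middleOf (mid s) v) + count (λ w → dangerNbr u w ∨ dangerNbr v w))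
      ≤⟨ +-monoʳ-≤ (count (middleOf (mid s) u))
                   (+-monoʳ-≤ (count (middleOf (mid s) v)) (count-∨ (dangerNbr u) _)) ⟩
        count (middleOf (mid s) u) + (count (middleOf (mid s) v) + (count (dangerNbr u) + count (dangerNbr v)))
      ≤⟨ +-mono-≤ (middleOf-bound (mid s) u) (+-mono-≤ (middleOf-bound (mid s) v)
                                               (+-mono-≤ (dangerNbr-bound u) (dangerNbr-bound v))) ⟩
        66
      ∎
      where open ≤-Reasoning

    -- A frozen leg seen from an endpoint makes w a middle of a bad pair at u
    -- or v.  Otherwise w is an endpoint of repaired pairs w,p and w,p′ with
    -- middles u and v; they are not both sparse, and a non-sparse one makes
    -- its middle a dangerNbr of w.
    blocked⇒culprit : ∀ w → (aH u w ∧ aH w v) ∧ (fixed s u w ∧ fixed s w v) ≡ true → culprit w ≡ true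
    blocked⇒culprit w hb with fixed⇒leg u w (∧-left (∧-right {aH u w ∧ aH w v} hb))
                            | fixed⇒leg v w (trans (fixed-sym v w)
                                                    (∧-right {fixed s u w} (∧-right {aH u w ∧ aH w v} hb)))
    ... | endpoint d m | _ = ∨-introˡ (endpoint⇒middleOf I d m)
    ... | middle _ _   | endpoint d m = ∨-introʳ {middleOf (mid s) u w} (∨-introˡ (endpoint⇒middleOf I d m))
    ... | middle {p} d m | middle {p′} d′ m′ with true-or-false (sparse w p) | true-or-false (sparse w p′)
    ...   | inj₂ ¬sp | _ = ∨-introʳ {middleOf (mid s) u w} (∨-introʳ {middleOf (mid s) v w} (∨-introˡ
                             (subst (λ z → dangerNbr z w ≡ true) m (middle⇒dangerNbr I d ¬sp))))
    ...   | inj₁ _ | inj₂ ¬sp = ∨-introʳ {middleOf (mid s) u w} (∨-introʳ {middleOf (mid s) v w}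
                             (∨-introʳ {dangerNbr u w} (subst (λ z → dangerNbr z w ≡ true) m′ (middle⇒dangerNbr I d′ ¬sp))))
    ...   | inj₁ sp | inj₁ sp′ = ⊥-elim (u≢v (trans (sym m) (trans (cong (mid s w) (sparse-unique w sp sp′)) m′)))

    via-common-H-neighbour : sparse u v ≡ false → ∃ λ w → candidate s u v w ≡ true
    via-common-H-neighbour ¬sp
      with escape (λ w → aH u w ∧ aH w v) (λ w → fixed s u w ∧ fixed s w v) 66
                  (exceeds _ 66 (not-false (==-false u≢v)) (not-false (¬aG⇒¬aH uv-¬G)) ¬sp)
                  (≤-trans (count-mono blocked⇒culprit) culprit-bound)
    ... | w , ok = w , ∧-intro (H⊆G u w (∧-left inH)) (∧-intro (H⊆G w v (∧-right {aH u w} inH))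
                           (∧-intro (∨-introʳ {sparse u v} inH) (∧-right {aH u w ∧ aH w v} ok)))
      where
        inH : aH u w ∧ aH w v ≡ true
        inH = ∧-left ok

    admissible : ∃ λ w → candidate s u v w ≡ true
    admissible with inPhase-cases φ u v uv-phase
    ... | inj₁ (φ≡true , sp) = via-common-neighbour φ≡true sp
    ... | inj₂ (_ , ¬sp)     = via-common-H-neighbour ¬sp

  findMiddle : ∀ s u v → Dec (∃ λ w → candidate s u v w ≡ true)
  findMiddle s u v = any? (λ w → candidate s u v w Bool.≟ true)

  step : Bool → State → Fin n × Fin n → State
  step φ s (u , v) with eligible φ s u v
  ... | false = s
  ... | true with findMiddle s u v
  ...   | no  _       = s
  ...   | yes (w , _) = Repair.after s u v w

  step-invariant : ∀ φ s uv → Invariant φ s → Invariant φ (step φ s uv)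
  step-invariant φ s (u , v) I with eligible φ s u v in elig
  ... | false = I
  ... | true with findMiddle s u v
  ...   | no  _        = I
  ...   | yes (w , cw) = RepairStep.invariant I elig cw

  step-keeps : ∀ φ s uv {x y} → Invariant φ s → done s x y ≡ true → done (step φ s uv) x y ≡ true
  step-keeps φ s (u , v) I d with eligible φ s u v in elig
  ... | false = d
  ... | true with findMiddle s u v
  ...   | no  _        = d
  ...   | yes (w , cw) = RepairStep.done-kept I elig cw d

  step-repairs : DiameterAtMost2 G → ∀ φ s u v → Invariant φ s → bad u v ≡ true → inPhase φ u v ≡ true →
    done (step φ s (u , v)) u v ≡ true
  step-repairs diam φ s u v I b ph with eligible φ s u v in elig
  ... | false = already-done b ph elig
    where
      already-done : ∀ {a d p} → a ≡ true → p ≡ true → a ∧ not d ∧ p ≡ false → d ≡ true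
      already-done {d = true} _ _ _ = refl
      already-done {d = false} refl refl ()
  ... | true with findMiddle s u v
  ...   | no  none     = contradiction (Existence.admissible diam I elig) none
  ...   | yes (w , cw) = RepairStep.done-uv I elig cw

  allPairs : List (Fin n × Fin n)
  allPairs = cartesianProduct (allFin n) (allFin n)

  runPhase : Bool → State → State
  runPhase φ s = foldl (step φ) s allPairs

  runPhase-invariant : ∀ φ {s} → Invariant φ s → Invariant φ (runPhase φ s)
  runPhase-invariant φ = run-preserves (Invariant φ) (step-invariant φ) allPairs
    where open Iteration (step φ)

  runPhase-keeps : ∀ φ {s x y} → Invariant φ s → done s x y ≡ true → done (runPhase φ s) x y ≡ true
  runPhase-keeps φ {x = x} {y} I d =
    proj₂ (run-preserves (λ s → Invariant φ s × done s x y ≡ true)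
                         (λ s uv (I , d) → step-invariant φ s uv I , step-keeps φ s uv I d) allPairs (I , d))
    where open Iteration (step φ)

  runPhase-repairs : DiameterAtMost2 G → ∀ φ {s} u v → Invariant φ s → bad u v ≡ true → inPhase φ u v ≡ true →
    done (runPhase φ s) u v ≡ true
  runPhase-repairs diam φ u v I b ph =
    run-establishes (Invariant φ) (λ s → done s u v ≡ true) (step-invariant φ) (λ s uv I d → step-keeps φ s uv I d)
                    (∈-cartesianProduct⁺ (∈-allFin u) (∈-allFin v)) (λ s I → step-repairs diam φ s u v I b ph) I
    where open Iteration (step φ)

  module RecolouredBound {φ : Bool} {s : State} (I : Invariant φ s) (a : Fin n) where
    open Invariant I

    changed : Fin n → Bool
    changed w = aH a w ∧ not (colour s a w == c₀ a w)

    unchanged : ∀ {w} → aH a w ≡ true → changed w ≡ false → colour s a w ≡ c₀ a w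
    unchanged {w} h ¬ch with colour s a w ≟ c₀ a w
    ... | yes same = same
    ... | no  _    rewrite h with () ← ¬ch

    badᴴ bad¬ᴴ : Fin n → Bool
    badᴴ  q = bad a q ∧ aH a (mid s a q)
    bad¬ᴴ q = bad a q ∧ not (aH a (mid s a q))

    endMiddle : Fin n → Bool
    endMiddle w = anyF (λ q → badᴴ q ∧ (mid s a q == w))

    forcedBy : Fin n → Fin n → Fin n → Bool
    forcedBy w p r = sparse w p ∧ sparse a r ∧ bad a r ∧ (mid s a r == p) ∧ not (aH a p)

    forcedAt : Fin n → Bool
    forcedAt w = anyF (λ p → anyF (forcedBy w p))

    changed⇒kinds : ∀ w → changed w ≡ true → (endMiddle w ∨ forcedAt w) ∨ dangerNbr a w ≡ true
    changed⇒kinds w ch with recoloured a w (∧-left ch) (==-false⇒≢ (not-true (∧-right {aH a w} ch)))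
    ... | endpoint {q} d refl = ∨-introˡ (∨-introˡ (anyF-intro (λ q′ → badᴴ q′ ∧ (mid s a q′ == mid s a q)) {q}
            (∧-intro (∧-intro (done⇒bad a q d) (∧-left ch)) (==-refl (mid s a q)))))
    ... | middle {p} d refl h = ∨-introʳ {endMiddle w ∨ forcedAt w}
            (anyF-intro (λ p′ → dang w p′ ∧ aH a w ∧ aH a p′) {p}
              (∧-intro (∧-left {dang w p} (done⇒bad w p d)) (∧-intro (∧-left ch) h)))
    ... | forced {p} {r} _ sp refl h d′ sp′ m′ = ∨-introˡ (∨-introʳ {endMiddle w}
            (anyF-intro (λ p′ → anyF (forcedBy w p′)) {p} (anyF-intro (forcedBy w p) {r}
              (∧-intro sp (∧-intro sp′ (∧-intro (done⇒bad a r d′)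
                (∧-intro (subst (λ z → (mid s a r == z) ≡ true) m′ (==-refl (mid s a r))) (not-false h))))))))

    forced-witness : ∀ w → forcedAt w ≡ true →
      ∃ λ p → ∃ λ r → sparse w p ≡ true × sparse a r ≡ true × bad a r ≡ true × mid s a r ≡ p × aH a p ≡ false
    forced-witness w f =
      let (p , fp)  = anyF-elim (λ p → anyF (forcedBy w p)) f
          (r , fpr) = anyF-elim (forcedBy w p) fp
          rest₁ = ∧-right {sparse w p} fpr
          rest₂ = ∧-right {sparse a r} rest₁
          rest₃ = ∧-right {bad a r} rest₂
      in p , r , ∧-left fpr , ∧-left rest₁ , ∧-left rest₂ ,
         ==-sound (∧-left rest₃) , not-true (∧-right {mid s a r == p} rest₃)

    forced-unique : ∀ w w′ → forcedAt w ≡ true → forcedAt w′ ≡ true → w ≡ w′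
    forced-unique w w′ f f′ with forced-witness w f | forced-witness w′ f′
    ... | p , r , wp , ar , _ , m , _ | p′ , r′ , w′p′ , ar′ , _ , m′ , _ =
      sparse-unique p (trans (sparse-sym p w) wp)
                      (subst (λ z → sparse z w′ ≡ true) p′≡p (trans (sparse-sym p′ w′) w′p′))
      where
        p′≡p : p′ ≡ p
        p′≡p = trans (sym m′) (trans (cong (mid s a) (sparse-unique a ar′ ar)) m)

    forced-bound : count forcedAt ≤ count bad¬ᴴ
    forced-bound = bounded-by (atMostOne⇒count≤1 forcedAt forced-unique) some-bad¬ᴴ
      where
        bounded-by : ∀ {k m} → k ≤ 1 → (1 ≤ k → 1 ≤ m) → k ≤ m
        bounded-by {zero}        _ _   = z≤n
        bounded-by {suc zero}    _ pos = pos (s≤s z≤n)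
        bounded-by {suc (suc _)} (s≤s ()) _
        some-bad¬ᴴ : 1 ≤ count forcedAt → 1 ≤ count bad¬ᴴ
        some-bad¬ᴴ pos =
          let (w , f) = count-witness forcedAt pos
              (p , r , _ , _ , b , m , ¬h) = forced-witness w f
          in count-pos bad¬ᴴ {r} (∧-intro b (not-false (trans (cong (aH a) m) ¬h)))

    changed-bound : count changed ≤ 33
    changed-bound = begin
        count changed
      ≤⟨ count-mono changed⇒kinds ⟩
        count (λ w → (endMiddle w ∨ forcedAt w) ∨ dangerNbr a w)
      ≤⟨ count-∨ (λ w → endMiddle w ∨ forcedAt w) (dangerNbr a) ⟩
        count (λ w → endMiddle w ∨ forcedAt w) + count (dangerNbr a)
      ≤⟨ +-monoˡ-≤ (count (dangerNbr a)) (count-∨ endMiddle forcedAt) ⟩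
        (count endMiddle + count forcedAt) + count (dangerNbr a)
      ≤⟨ +-mono-≤ (+-mono-≤ (count-image badᴴ (mid s a)) forced-bound) (dangerNbr-bound a) ⟩
        (count badᴴ + count bad¬ᴴ) + 30
      ≡⟨ cong (_+ 30) (sym (count-split (bad a) (λ q → aH a (mid s a q)))) ⟩
        count (bad a) + 30
      ≤⟨ +-monoˡ-≤ 30 (bad-bound a) ⟩
        33
      ∎
      where open ≤-Reasoning

  rainbowᶜ : Fin n → Fin n → Fin n → Bool
  rainbowᶜ a b w = aH a w ∧ aH w b ∧ not (c₀ a w == c₀ w b)

  -- A distinct pair that is neither adjacent in G nor bad is not dangerous,
  -- so it has at least 67 rainbow paths in (H, c).
  many-rainbow : ∀ {a b} → a ≢ b → aG a b ≡ false → bad a b ≡ false → 67 ≤ count (rainbowᶜ a b)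
  many-rainbow {a} {b} a≢b ¬ab ¬bad = exceeds _ 66 (not-false (==-false a≢b)) (not-false (¬aG⇒¬aH ¬ab)) ¬dang
    where
      ¬dang : dang a b ≡ false
      ¬dang with dang a b
      ... | false = refl
      ... | true  = trans (sym (cong not ¬ab)) ¬bad

  -- At most 33 + 33 of these paths use a recoloured edge, so one of them is
  -- still rainbow.
  surviving-rainbow : ∀ {φ s} → Invariant φ s → ∀ {a b} → a ≢ b → aG a b ≡ false → bad a b ≡ false →
    ∃ λ w → aG a w ≡ true × aG w b ≡ true × colour s a w ≢ colour s w b
  surviving-rainbow {s = s} I {a} {b} a≢b ¬ab ¬bad
    with escape (rainbowᶜ a b) spoiled 66 (many-rainbow a≢b ¬ab ¬bad)
                (≤-trans (count-mono {f = λ w → rainbowᶜ a b w ∧ spoiled w} (λ w r → ∧-right {rainbowᶜ a b w} r))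
                         (≤-trans (count-∨ changedᵃ changedᵇ) (+-mono-≤ boundᵃ boundᵇ)))
    where
      open RecolouredBound I a using () renaming (changed to changedᵃ; changed-bound to boundᵃ)
      open RecolouredBound I b using () renaming (changed to changedᵇ; changed-bound to boundᵇ)
      spoiled : Fin n → Bool
      spoiled w = changedᵃ w ∨ changedᵇ w
  ... | w , ok = w , H⊆G a w aw , H⊆G w b wb , distinct
    where
      aw : aH a w ≡ true
      aw = ∧-left (∧-left ok)
      wb : aH w b ≡ true
      wb = ∧-left (∧-right {aH a w} (∧-left ok))
      c₀-distinct : c₀ a w ≢ c₀ w b
      c₀-distinct = ==-false⇒≢ (not-true (∧-right {aH w b} (∧-right {aH a w} (∧-left ok))))
      unspoiled : RecolouredBound.changed I a w ≡ false × RecolouredBound.changed I b w ≡ false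
      unspoiled = neither (not-true (∧-right {rainbowᶜ a b w} ok))
      distinct : colour s a w ≢ colour s w b
      distinct eq = c₀-distinct (begin
          c₀ a w        ≡⟨ sym (RecolouredBound.unchanged I a aw (proj₁ unspoiled)) ⟩
          colour s a w  ≡⟨ eq ⟩
          colour s w b  ≡⟨ Invariant.colour-sym I w b ⟩
          colour s b w  ≡⟨ RecolouredBound.unchanged I b (trans (aH-sym b w) wb) (proj₂ unspoiled) ⟩
          c₀ b w        ≡⟨ colSym c b w ⟩
          c₀ w b        ∎)
        where open ≡-Reasoning

  module Conclusion (diam : DiameterAtMost2 G) where

    afterSparse final : State
    afterSparse = runPhase true initial
    final       = runPhase false afterSparse

    relax : ∀ {s} → Invariant true s → Invariant false s
    relax I = record { Invariant I ; only-sparse = λ () }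

    final-invariant : Invariant false final
    final-invariant = runPhase-invariant false (relax (runPhase-invariant true initial-invariant))

    all-repaired : ∀ u v → bad u v ≡ true → State.done final u v ≡ true
    all-repaired u v b with true-or-false (sparse u v)
    ... | inj₁ sp  = runPhase-keeps false (relax (runPhase-invariant true initial-invariant))
                       (runPhase-repairs diam true u v initial-invariant b sp)
    ... | inj₂ ¬sp = runPhase-repairs diam false u v (relax (runPhase-invariant true initial-invariant))
                       b (not-false ¬sp)

    colouring : EdgeColouring G 2
    colouring = record { col = State.colour final ; colSym = Invariant.colour-sym final-invariant }

    rainbow-connected : RainbowConnected G colouring
    rainbow-connected u v with u ≟ v
    ... | yes refl = trivialPath colouring u
    ... | no  u≢v with true-or-false (aG u v)
    ...   | inj₁ uv = edgePath colouring u≢v uv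
    ...   | inj₂ ¬uv with true-or-false (bad u v)
    ...     | inj₁ b = twoEdgePath colouring u≢v edgeˡ edgeʳ rainbow
      where open RainbowVia (Invariant.done⇒rainbow final-invariant u v (all-repaired u v b))
    ...     | inj₂ ¬b = let (w , uw , wv , distinct) = surviving-rainbow final-invariant u≢v ¬uv ¬b
                        in twoEdgePath colouring u≢v uw wv distinct

proposition2 : ∀ {n : ℕ} (G : Graph n) → PropertyM G → DiameterAtMost2 G → RcAtMost G 2
proposition2 G (H , H⊆G , c , M) diam = colouring , rainbow-connected
  where open Setting.Conclusion G H c H⊆G M diam
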